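{- Let $G$ be a non-Petersen brick with $m$ edges and $n$ vertices, let $d=m-n+1$, and let $M_1,\dots,M_d$ be perfect matchings of $G$ (viewed as $0/1$ vectors in $\mathbb{R}^{E}$) forming a basis of the matching lattice of $G$ such that, for every $1\le i\le d-1$, $M_{i+1}$ contains an edge $e_{i+1}$ not used by any of $M_1,\dots,M_i$. If $x\in\mathbb{R}^d$ satisfies $\sum_{i=1}^d x_iM_i=\mathbf{1}$, then $|x_{d-i}|\le 2^i$ for all $0\le i\le d-1$.
   Context: Graphs are finite, loopless, and may have parallel edges. A brick is a $3$-connected graph $H$ such that $H-x-y$ has a perfect matching for every pair of vertices $x,y$; a non-Petersen brick is a brick whose underlying simple graph is not the Petersen graph. The matching lattice of $G$ is the set of integer combinations of incidence vectors of perfect matchings of $G$; $\mathbf{1}$ denotes the all-ones vector in $\mathbb{R}^E$.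
   Formalization: The vector x, solving the equation with the perfect matchings, is taken in ℚ^d rather than ℝ^d. -}

module Defs where

open import Data.Nat as ℕ using (ℕ; zero; suc; _≤_; _<_; _∸_)
open import Data.Integer as ℤ using (ℤ)
open import Data.Rational as ℚ using (ℚ)
open import Data.Fin using (Fin; zero; suc; toℕ)
open import Data.Bool using (Bool; true; false; if_then_else_)
open import Data.Product using (Σ; ∃; _×_; _,_; proj₁; proj₂)
open import Data.Sum using (_⊎_)
open import Data.List using (List; []; _∷_)
open import Data.List.Membership.Propositional using (_∈_)
open import Function using (_∘_)
open import Function.Bundles using (_⤖_; Bijection; _⇔_)
open import Relation.Nullary using (¬_)
open import Relation.Binary.PropositionalEquality using (_≡_; _≢_)

sumℕ : ∀ {k} → (Fin k → ℕ) → ℕ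
sumℕ {zero} f = 0
sumℕ {suc k} f = f zero ℕ.+ sumℕ (f ∘ suc)

sumℤ : ∀ {k} → (Fin k → ℤ) → ℤ
sumℤ {zero} f = ℤ.0ℤ
sumℤ {suc k} f = f zero ℤ.+ sumℤ (f ∘ suc)

sumℚ : ∀ {k} → (Fin k → ℚ) → ℚ
sumℚ {zero} f = ℚ.0ℚ
sumℚ {suc k} f = f zero ℚ.+ sumℚ (f ∘ suc)

record Graph : Set where
  field
    n : ℕ
    m : ℕ
    ends : Fin m → Fin n × Fin n
    loopless : ∀ e → proj₁ (ends e) ≢ proj₂ (ends e)

module _ (G : Graph) where
  open Graph G

  Incident : Fin m → Fin n → Set
  Incident e v = (proj₁ (ends e) ≡ v) ⊎ (proj₂ (ends e) ≡ v)

  Joins : Fin m → Fin n → Fin n → Set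
  Joins e u w = (proj₁ (ends e) ≡ u × proj₂ (ends e) ≡ w)
              ⊎ (proj₁ (ends e) ≡ w × proj₂ (ends e) ≡ u)

  VSet : Set
  VSet = Fin n → Bool

  -- walks inside the vertex set `keep` from u to v (u is assumed kept)
  data Walk (keep : VSet) : Fin n → Fin n → Set where
    here : ∀ {u} → Walk keep u u
    step : ∀ {u w v} (e : Fin m) → Joins e u w → keep w ≡ true
         → Walk keep w v → Walk keep u v

  ConnectedOn : VSet → Set
  ConnectedOn keep = ∀ u v → keep u ≡ true → keep v ≡ true → Walk keep u v

  without2 : Fin n → Fin n → VSet
  without2 x y z with Data.Fin._≟_ z x | Data.Fin._≟_ z y
  ... | Relation.Nullary.yes _ | _ = false
  ... | Relation.Nullary.no _ | Relation.Nullary.yes _ = false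
  ... | Relation.Nullary.no _ | Relation.Nullary.no _ = true

  -- 3-connected: more than 3 vertices, and deleting any set of at most two
  -- vertices ({x,y}, with x = y allowed for single vertices) leaves a connected graph.
  -- (Deleting no vertex is implied by deleting one, since n ≥ 4.)
  ThreeConnected : Set
  ThreeConnected = 4 ≤ n × (∀ x y → ConnectedOn (without2 x y))

  ESet : Set
  ESet = Fin m → Bool

  degIn : ESet → Fin n → ℕ
  degIn M v = sumℕ (λ e → if M e then (if isInc e then 1 else 0) else 0)
    where
      isInc : Fin m → Bool
      isInc e with Data.Fin._≟_ (proj₁ (ends e)) v | Data.Fin._≟_ (proj₂ (ends e)) v
      ... | Relation.Nullary.yes _ | _ = true
      ... | Relation.Nullary.no _ | Relation.Nullary.yes _ = true
      ... | Relation.Nullary.no _ | Relation.Nullary.no _ = false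

  IsPerfectMatchingOn : VSet → ESet → Set
  IsPerfectMatchingOn keep M =
    (∀ e → M e ≡ true → keep (proj₁ (ends e)) ≡ true × keep (proj₂ (ends e)) ≡ true)
    × (∀ v → keep v ≡ true → degIn M v ≡ 1)

  IsPerfectMatching : ESet → Set
  IsPerfectMatching M = IsPerfectMatchingOn (λ _ → true) M

  PerfectMatching : Set
  PerfectMatching = Σ ESet IsPerfectMatching

  IsBrick : Set
  IsBrick = ThreeConnected
          × (∀ x y → x ≢ y → ∃ λ M → IsPerfectMatchingOn (without2 x y) M)

  Adj : Fin n → Fin n → Set
  Adj u v = ∃ λ e → Joins e u v

  χℤ : ESet → Fin m → ℤ
  χℤ M e = if M e then ℤ.1ℤ else ℤ.0ℤ

  χℚ : ESet → Fin m → ℚ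
  χℚ M e = if M e then ℚ.1ℚ else ℚ.0ℚ

  InMatchingLattice : (Fin m → ℤ) → Set
  InMatchingLattice w = Σ ℕ λ k → Σ (Fin k → ℤ) λ c → Σ (Fin k → PerfectMatching) λ N →
    ∀ e → w e ≡ sumℤ (λ j → c j ℤ.* χℤ (proj₁ (N j)) e)

  IsLatticeBasis : ∀ {d} → (Fin d → PerfectMatching) → Set
  IsLatticeBasis {d} M =
    (∀ w → InMatchingLattice w →
       ∃ λ (c : Fin d → ℤ) → ∀ e → w e ≡ sumℤ (λ i → c i ℤ.* χℤ (proj₁ (M i)) e))
    × (∀ (c : Fin d → ℤ) → (∀ e → sumℤ (λ i → c i ℤ.* χℤ (proj₁ (M i)) e) ≡ ℤ.0ℤ)
         → ∀ i → c i ≡ ℤ.0ℤ)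

-- The Petersen graph on Fin 10: outer 5-cycle 0..4, spokes i–i+5, inner pentagram.
petersenEdges : List (ℕ × ℕ)
petersenEdges =
  (0 , 1) ∷ (1 , 2) ∷ (2 , 3) ∷ (3 , 4) ∷ (4 , 0) ∷
  (0 , 5) ∷ (1 , 6) ∷ (2 , 7) ∷ (3 , 8) ∷ (4 , 9) ∷
  (5 , 7) ∷ (7 , 9) ∷ (9 , 6) ∷ (6 , 8) ∷ (8 , 5) ∷ []

PetersenAdj : Fin 10 → Fin 10 → Set
PetersenAdj i j = ((toℕ i , toℕ j) ∈ petersenEdges) ⊎ ((toℕ j , toℕ i) ∈ petersenEdges)

UnderlyingIsPetersen : Graph → Set
UnderlyingIsPetersen G = Σ (Fin (Graph.n G) ⤖ Fin 10) λ f →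
  ∀ u v → Adj G u v ⇔ PetersenAdj (Bijection.to f u) (Bijection.to f v)

IsNonPetersenBrick : Graph → Set
IsNonPetersenBrick G = IsBrick G × ¬ UnderlyingIsPetersen G

two^ : ℕ → ℚ
two^ i = ℤ.+ (2 ℕ.^ i) ℚ./ 1

dimG : Graph → ℕ
dimG G = Graph.m G ℕ.+ 1 ∸ Graph.n G

{-# OPTIONS --safe #-}
-- Pick edges e₀, …, e_{d-1} with eⱼ ∈ Mⱼ and eⱼ ∉ M₀ ∪ ⋯ ∪ M_{j-1} (for j = 0 any edge of
-- the nonempty matching M₀). Reading Σᵢ xᵢ Mᵢ = 𝟏 at eⱼ gives xⱼ + Σ_{i>j} xᵢ Mᵢ(eⱼ) = 1, a
-- unit upper-triangular system with 0/1 coefficients, so by backward induction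
-- |xⱼ| ≤ 1 + Σ_{i>j} 2^(d-1-i) = 2^(d-1-j).
module Submission where

open import Defs
open import Data.Nat using (ℕ; _∸_; _+_; _≤_; _<_)
open import Data.Rational as ℚ using (ℚ)
open import Data.Fin using (Fin; toℕ)
open import Data.Bool using (true; false)
open import Data.Product using (Σ; ∃; _×_; proj₁)
open import Relation.Binary.PropositionalEquality using (_≡_)

open import Data.Bool using (Bool; if_then_else_)
open import Data.Empty using (⊥-elim)
open import Data.Fin using (zero; suc; fromℕ<)
open import Data.Integer as ℤ using (ℤ; +_)
import Data.Integer.Properties as ℤP
open import Data.Nat as ℕ using (zero; suc; z≤n; s≤s)
import Data.Nat.Properties as ℕP
open import Data.Product using (_,_; proj₂)
import Data.Rational.Properties as ℚP
open import Algebra.Properties.Group ℚP.+-0-group using (//-rightDividesʳ)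
import Data.Rational.Unnormalised as ℚᵘ
import Data.Rational.Unnormalised.Properties as ℚᵘP
open import Function using (_∘_)
open import Relation.Binary.PropositionalEquality
  using (_≢_; refl; sym; trans; cong; cong₂; subst; module ≡-Reasoning)

/1-homo-+ : (a b : ℤ) → (a ℤ.+ b) ℚ./ 1 ≡ a ℚ./ 1 ℚ.+ b ℚ./ 1
/1-homo-+ a b = ℚP.toℚᵘ-injective (begin
  ℚ.toℚᵘ ((a ℤ.+ b) ℚ./ 1)               ≈⟨ ℚP.toℚᵘ-fromℚᵘ (ℚᵘ.mkℚᵘ (a ℤ.+ b) 0) ⟩
  ℚᵘ.mkℚᵘ (a ℤ.+ b) 0                    ≈⟨ ℚᵘ.*≡* (cong (ℤ._* + 1) (sym a*1+b*1≡a+b)) ⟩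
  ℚᵘ.mkℚᵘ a 0 ℚᵘ.+ ℚᵘ.mkℚᵘ b 0           ≈⟨ ℚᵘP.+-cong (fromℚᵘ-/1 a) (fromℚᵘ-/1 b) ⟩
  ℚ.toℚᵘ (a ℚ./ 1) ℚᵘ.+ ℚ.toℚᵘ (b ℚ./ 1) ≈⟨ ℚP.toℚᵘ-homo-+ (a ℚ./ 1) (b ℚ./ 1) ⟨
  ℚ.toℚᵘ (a ℚ./ 1 ℚ.+ b ℚ./ 1)           ∎)
  where
  open ℚᵘP.≃-Reasoning
  a*1+b*1≡a+b : a ℤ.* + 1 ℤ.+ b ℤ.* + 1 ≡ a ℤ.+ b
  a*1+b*1≡a+b = cong₂ ℤ._+_ (ℤP.*-identityʳ a) (ℤP.*-identityʳ b)
  fromℚᵘ-/1 : ∀ z → ℚᵘ.mkℚᵘ z 0 ℚᵘ.≃ ℚ.toℚᵘ (z ℚ./ 1)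
  fromℚᵘ-/1 z = ℚᵘP.≃-sym (ℚP.toℚᵘ-fromℚᵘ (ℚᵘ.mkℚᵘ z 0))

two^-suc : ∀ k → two^ (suc k) ≡ two^ k ℚ.+ two^ k
two^-suc k = begin
  + (a ℕ.+ (a ℕ.+ 0)) ℚ./ 1 ≡⟨ cong (λ n → + (a ℕ.+ n) ℚ./ 1) (ℕP.+-identityʳ a) ⟩
  + (a ℕ.+ a) ℚ./ 1         ≡⟨ cong (ℚ._/ 1) (ℤP.pos-+ a a) ⟩
  (+ a ℤ.+ + a) ℚ./ 1       ≡⟨ /1-homo-+ (+ a) (+ a) ⟩
  two^ k ℚ.+ two^ k         ∎
  where
  open ≡-Reasoning
  a = 2 ℕ.^ k

sumℚ-cong : ∀ {k} {f g : Fin k → ℚ} → (∀ i → f i ≡ g i) → sumℚ f ≡ sumℚ g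
sumℚ-cong {zero}  f≡g = refl
sumℚ-cong {suc k} f≡g = cong₂ ℚ._+_ (f≡g zero) (sumℚ-cong (f≡g ∘ suc))

sumℚ-mono-≤ : ∀ {k} {f g : Fin k → ℚ} → (∀ i → f i ℚ.≤ g i) → sumℚ f ℚ.≤ sumℚ g
sumℚ-mono-≤ {zero}  f≤g = ℚP.≤-refl
sumℚ-mono-≤ {suc k} f≤g = ℚP.+-mono-≤ (f≤g zero) (sumℚ-mono-≤ (f≤g ∘ suc))

∣sumℚ∣≤sumℚ∣∣ : ∀ {k} (f : Fin k → ℚ) → ℚ.∣ sumℚ f ∣ ℚ.≤ sumℚ (λ i → ℚ.∣ f i ∣)
∣sumℚ∣≤sumℚ∣∣ {zero}  f = ℚP.≤-refl
∣sumℚ∣≤sumℚ∣∣ {suc k} f = ℚP.≤-trans (ℚP.∣p+q∣≤∣p∣+∣q∣ (f zero) (sumℚ (f ∘ suc)))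
  (ℚP.+-monoʳ-≤ ℚ.∣ f zero ∣ (∣sumℚ∣≤sumℚ∣∣ (f ∘ suc)))

1+sumℚ-two^≡two^ : ∀ k → ℚ.1ℚ ℚ.+ sumℚ {k} (λ i → two^ (k ∸ 1 ∸ toℕ i)) ≡ two^ k
1+sumℚ-two^≡two^ zero    = refl
1+sumℚ-two^≡two^ (suc k) = begin
  ℚ.1ℚ ℚ.+ (two^ k ℚ.+ sumℚ {k} (λ i → two^ (k ∸ suc (toℕ i))))
    ≡⟨ cong (λ s → ℚ.1ℚ ℚ.+ (two^ k ℚ.+ s)) (sumℚ-cong {k} (λ i → cong two^ (sym (ℕP.∸-+-assoc k 1 (toℕ i))))) ⟩
  ℚ.1ℚ ℚ.+ (two^ k ℚ.+ S)  ≡⟨ sym (ℚP.+-assoc ℚ.1ℚ (two^ k) S) ⟩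
  ℚ.1ℚ ℚ.+ two^ k ℚ.+ S    ≡⟨ cong (ℚ._+ S) (ℚP.+-comm ℚ.1ℚ (two^ k)) ⟩
  two^ k ℚ.+ ℚ.1ℚ ℚ.+ S    ≡⟨ ℚP.+-assoc (two^ k) ℚ.1ℚ S ⟩
  two^ k ℚ.+ (ℚ.1ℚ ℚ.+ S)  ≡⟨ cong (two^ k ℚ.+_) (1+sumℚ-two^≡two^ k) ⟩
  two^ k ℚ.+ two^ k        ≡⟨ two^-suc k ⟨
  two^ (suc k)             ∎
  where
  open ≡-Reasoning
  S : ℚ
  S = sumℚ {k} (λ i → two^ (k ∸ 1 ∸ toℕ i))

∣p*q∣≤∣p∣ : ∀ p {q} → ℚ.∣ q ∣ ℚ.≤ ℚ.1ℚ → ℚ.∣ p ℚ.* q ∣ ℚ.≤ ℚ.∣ p ∣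
∣p*q∣≤∣p∣ p {q} ∣q∣≤1 = begin
  ℚ.∣ p ℚ.* q ∣         ≡⟨ ℚP.∣p*q∣≡∣p∣*∣q∣ p q ⟩
  ℚ.∣ p ∣ ℚ.* ℚ.∣ q ∣   ≤⟨ ℚP.*-monoˡ-≤-nonNeg ℚ.∣ p ∣ {{ℚP.∣-∣-nonNeg p}} ∣q∣≤1 ⟩
  ℚ.∣ p ∣ ℚ.* ℚ.1ℚ      ≡⟨ ℚP.*-identityʳ ℚ.∣ p ∣ ⟩
  ℚ.∣ p ∣               ∎
  where open ℚP.≤-Reasoning

∣sumℚ-*∣≤sumℚ∣∣ : ∀ {k} (x c : Fin k → ℚ) → (∀ i → ℚ.∣ c i ∣ ℚ.≤ ℚ.1ℚ) →
  ℚ.∣ sumℚ (λ i → x i ℚ.* c i) ∣ ℚ.≤ sumℚ (λ i → ℚ.∣ x i ∣)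
∣sumℚ-*∣≤sumℚ∣∣ x c ∣c∣≤1 = ℚP.≤-trans (∣sumℚ∣≤sumℚ∣∣ (λ i → x i ℚ.* c i))
  (sumℚ-mono-≤ (λ i → ∣p*q∣≤∣p∣ (x i) (∣c∣≤1 i)))

record IsUnitUpperTriangular {d} (c : Fin d → Fin d → ℚ) : Set where
  field
    diagonal   : ∀ j → c j j ≡ ℚ.1ℚ
    zero-below : ∀ j i → toℕ i < toℕ j → c j i ≡ ℚ.0ℚ

SolvesAllOnes : ∀ {d} → (Fin d → Fin d → ℚ) → (Fin d → ℚ) → Set
SolvesAllOnes c x = ∀ j → sumℚ (λ i → x i ℚ.* c j i) ≡ ℚ.1ℚ

tailMatrix : ∀ {d} → (Fin (suc d) → Fin (suc d) → ℚ) → Fin d → Fin d → ℚ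
tailMatrix c j i = c (suc j) (suc i)

module _ {d} {c : Fin (suc d) → Fin (suc d) → ℚ} (T : IsUnitUpperTriangular c) where
  open IsUnitUpperTriangular T

  tailMatrix-isUnitUpperTriangular : IsUnitUpperTriangular (tailMatrix c)
  tailMatrix-isUnitUpperTriangular = record
    { diagonal   = diagonal ∘ suc
    ; zero-below = λ j i i<j → zero-below (suc j) (suc i) (s≤s i<j)
    }

  module _ {x : Fin (suc d) → ℚ} (solves : SolvesAllOnes c x) where

    tailMatrix-solvesAllOnes : SolvesAllOnes (tailMatrix c) (x ∘ suc)
    tailMatrix-solvesAllOnes j = begin
      S                                   ≡⟨ ℚP.+-identityˡ S ⟨
      ℚ.0ℚ ℚ.+ S                          ≡⟨ cong (ℚ._+ S) x₀*0≡0 ⟨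
      x zero ℚ.* c (suc j) zero ℚ.+ S     ≡⟨ solves (suc j) ⟩
      ℚ.1ℚ                                ∎
      where
      open ≡-Reasoning
      S : ℚ
      S = sumℚ (λ i → x (suc i) ℚ.* tailMatrix c j i)
      x₀*0≡0 : x zero ℚ.* c (suc j) zero ≡ ℚ.0ℚ
      x₀*0≡0 = trans (cong (x zero ℚ.*_) (zero-below (suc j) zero (s≤s z≤n))) (ℚP.*-zeroʳ (x zero))

    head-≡-1-sumℚ : x zero ≡ ℚ.1ℚ ℚ.- sumℚ (λ i → x (suc i) ℚ.* c zero (suc i))
    head-≡-1-sumℚ = begin
      x zero                             ≡⟨ //-rightDividesʳ S (x zero) ⟨
      x zero ℚ.+ S ℚ.- S                 ≡⟨ cong (λ y → y ℚ.+ S ℚ.- S) (ℚP.*-identityʳ (x zero)) ⟨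
      x zero ℚ.* ℚ.1ℚ ℚ.+ S ℚ.- S        ≡⟨ cong (λ y → x zero ℚ.* y ℚ.+ S ℚ.- S) (diagonal zero) ⟨
      x zero ℚ.* c zero zero ℚ.+ S ℚ.- S ≡⟨ cong (ℚ._- S) (solves zero) ⟩
      ℚ.1ℚ ℚ.- S                         ∎
      where
      open ≡-Reasoning
      S : ℚ
      S = sumℚ (λ i → x (suc i) ℚ.* c zero (suc i))

unitUpperTriangular-solution-bound : ∀ {d} {c : Fin d → Fin d → ℚ} {x : Fin d → ℚ} →
  IsUnitUpperTriangular c → (∀ j i → ℚ.∣ c j i ∣ ℚ.≤ ℚ.1ℚ) → SolvesAllOnes c x →
  ∀ k → ℚ.∣ x k ∣ ℚ.≤ two^ (d ∸ 1 ∸ toℕ k)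
unitUpperTriangular-solution-bound {suc d} {c} {x} T ∣c∣≤1 solves = bound
  where
  IH : ∀ k → ℚ.∣ x (suc k) ∣ ℚ.≤ two^ (d ∸ 1 ∸ toℕ k)
  IH = unitUpperTriangular-solution-bound (tailMatrix-isUnitUpperTriangular T)
         (λ j i → ∣c∣≤1 (suc j) (suc i)) (tailMatrix-solvesAllOnes T {x} solves)
  S : ℚ
  S = sumℚ (λ i → x (suc i) ℚ.* c zero (suc i))
  bound : ∀ k → ℚ.∣ x k ∣ ℚ.≤ two^ (d ∸ toℕ k)
  bound zero = begin
    ℚ.∣ x zero ∣                                   ≡⟨ cong ℚ.∣_∣ (head-≡-1-sumℚ T {x} solves) ⟩
    ℚ.∣ ℚ.1ℚ ℚ.- S ∣                               ≤⟨ ℚP.∣p-q∣≤∣p∣+∣q∣ ℚ.1ℚ S ⟩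
    ℚ.1ℚ ℚ.+ ℚ.∣ S ∣                               ≤⟨ ℚP.+-monoʳ-≤ ℚ.1ℚ ∣S∣≤ ⟩
    ℚ.1ℚ ℚ.+ sumℚ {d} (λ i → ℚ.∣ x (suc i) ∣)      ≤⟨ ℚP.+-monoʳ-≤ ℚ.1ℚ (sumℚ-mono-≤ IH) ⟩
    ℚ.1ℚ ℚ.+ sumℚ {d} (λ i → two^ (d ∸ 1 ∸ toℕ i)) ≡⟨ 1+sumℚ-two^≡two^ d ⟩
    two^ d                                         ∎
    where
    open ℚP.≤-Reasoning
    ∣S∣≤ : ℚ.∣ S ∣ ℚ.≤ sumℚ (λ i → ℚ.∣ x (suc i) ∣)
    ∣S∣≤ = ∣sumℚ-*∣≤sumℚ∣∣ (x ∘ suc) (c zero ∘ suc) (∣c∣≤1 zero ∘ suc)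
  bound (suc k) = subst (ℚ.∣ x (suc k) ∣ ℚ.≤_) (cong two^ (ℕP.∸-+-assoc d 1 (toℕ k))) (IH k)

sumℕ≢0⇒∃≢0 : ∀ {k} (f : Fin k → ℕ) → sumℕ f ≢ 0 → ∃ λ i → f i ≢ 0
sumℕ≢0⇒∃≢0 {zero}  f sum≢0 = ⊥-elim (sum≢0 refl)
sumℕ≢0⇒∃≢0 {suc k} f sum≢0 with f zero in eq
... | zero  = let (i , fi≢0) = sumℕ≢0⇒∃≢0 (f ∘ suc) sum≢0 in suc i , fi≢0
... | suc _ = zero , λ f₀≡0 → ℕP.1+n≢0 (trans (sym eq) f₀≡0)

if-then-else-≢-else⇒true : ∀ {A : Set} (b : Bool) {x y : A} → (if b then x else y) ≢ y → b ≡ true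
if-then-else-≢-else⇒true true  _   = refl
if-then-else-≢-else⇒true false x≢y = ⊥-elim (x≢y refl)

perfectMatching-nonempty : (G : Graph) → Fin (Graph.n G) → (M : PerfectMatching G) →
  ∃ λ e → proj₁ M e ≡ true
perfectMatching-nonempty G v (M , _ , deg≡1) =
  let (e , term≢0) = sumℕ≢0⇒∃≢0 _ (λ deg≡0 → ℕP.1+n≢0 (trans (sym (deg≡1 v refl)) deg≡0))
  in e , if-then-else-≢-else⇒true (M e) term≢0

∣χℚ∣≤1 : (G : Graph) (M : ESet G) (e : Fin (Graph.m G)) → ℚ.∣ χℚ G M e ∣ ℚ.≤ ℚ.1ℚ
∣χℚ∣≤1 G M e with M e
... | true  = ℚP.≤-refl
... | false = ℚP.nonNegative⁻¹ ℚ.1ℚ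

module _ (G : Graph) {d} (M : Fin d → ESet G) where

  IsNewEdge : Fin d → Fin (Graph.m G) → Set
  IsNewEdge j e = M j e ≡ true × (∀ k → toℕ k < toℕ j → M k e ≡ false)

  newEdges-isUnitUpperTriangular : (e : Fin d → Fin (Graph.m G)) → (∀ j → IsNewEdge j (e j)) →
    IsUnitUpperTriangular (λ j i → χℚ G (M i) (e j))
  newEdges-isUnitUpperTriangular e new = record
    { diagonal   = λ j → cong (λ b → if b then ℚ.1ℚ else ℚ.0ℚ) (proj₁ (new j))
    ; zero-below = λ j i i<j → cong (λ b → if b then ℚ.1ℚ else ℚ.0ℚ) (proj₂ (new j) i i<j)
    }

  newEdge-from-nonempty : (∀ j → ∃ λ e → M j e ≡ true) → (∀ j → 1 ≤ toℕ j → ∃ (IsNewEdge j)) →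
    ∀ j → ∃ (IsNewEdge j)
  newEdge-from-nonempty nonempty new zero    = let (e , e∈M₀) = nonempty zero in e , e∈M₀ , λ _ ()
  newEdge-from-nonempty nonempty new (suc j) = new (suc j) (s≤s z≤n)

lemma4 : (G : Graph) → IsNonPetersenBrick G →
    (M : Fin (dimG G) → PerfectMatching G) → IsLatticeBasis G M →
    (∀ (j : Fin (dimG G)) → 1 ≤ toℕ j →
       ∃ λ e → proj₁ (M j) e ≡ true × (∀ (k : Fin (dimG G)) → toℕ k < toℕ j → proj₁ (M k) e ≡ false)) →
    (x : Fin (dimG G) → ℚ) →
    (∀ e → sumℚ (λ i → x i ℚ.* χℚ G (proj₁ (M i)) e) ≡ ℚ.1ℚ) →
    ∀ (k : Fin (dimG G)) → ℚ.∣ x k ∣ ℚ.≤ two^ (dimG G ∸ 1 ∸ toℕ k)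
lemma4 G (((4≤n , _) , _) , _) M _ newAfterFirst x sum≡1 =
  unitUpperTriangular-solution-bound
    (newEdges-isUnitUpperTriangular G (proj₁ ∘ M) edge (proj₂ ∘ new))
    (λ j i → ∣χℚ∣≤1 G (proj₁ (M i)) (edge j))
    (sum≡1 ∘ edge)
  where
  new : ∀ j → ∃ (IsNewEdge G (proj₁ ∘ M) j)
  new = newEdge-from-nonempty G (proj₁ ∘ M) (perfectMatching-nonempty G (fromℕ< 4≤n) ∘ M) newAfterFirst
  edge : Fin (dimG G) → Fin (Graph.m G)
  edge = proj₁ ∘ new
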